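{- Let $V$ be a finite set and let $T_1,\dots,T_N$ be $T_0$-topologies on $V$. Form the tuple $G=(V,E,w,d)$ as described in the context. Then each topology $T_i$, $i=1,\dots,N$, can be recovered from $G$; that is, $(T_1,\dots,T_N)$ is uniquely determined by $(V,E,w,d)$.
   Context: For $i=1,\dots,N$, let $H_i$ be the Hasse diagram (a directed acyclic graph on $V$) of the finite $T_0$-space $(V,T_i)$ (equivalently, of the partial order on $V$ associated with $T_i$), and let $G_i=(V,E_i)$ be the simple undirected graph underlying $H_i$. Let $E=\bigcup_{i=1}^N E_i$ and, for $e\in E$, let $I(e)=\{i\in\{1,\dots,N\}\mid e\in E_i\}$. Fix distinct prime numbers $p_1,\dots,p_N$ and define the edge weight $w\colon E\to\mathbb{Q}$, $w(e)=\prod_{i\in I(e)}p_i^{ -1}$. Define $d\colon V\to\mathbb{N}^N$, $d(v)=(d_1(v),\dots,d_N(v))$, where $d_i(v)$ is the dimension of $v$ viewed as a point of the $T_0$-space $(V,T_i)$, i.e. the length of a maximal chain in $T_i$ (ending at $v$). -}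

module Defs where

open import Data.Nat using (ℕ; zero; suc; _≤_)
open import Data.Integer using (+_)
open import Data.Rational using (ℚ; _/_; _*_; 1ℚ; 0ℚ)
open import Data.Bool using (Bool; true; false; if_then_else_)
open import Data.Fin using (Fin)
open import Data.Fin.Subset using (Subset; _∈_; _∉_; _∪_; _∩_; ⊥; ⊤)
open import Data.Fin.Subset.Properties using (_∈?_; anySubset?)
open import Data.Fin.Properties using (_≟_; any?)
open import Data.List using (List; foldr; map)
open import Data.List using () renaming (allFin to allFinL)
open import Data.Product using (_×_; _,_; ∃; Σ)
open import Data.Sum using (_⊎_; inj₁; inj₂)
open import Relation.Binary.PropositionalEquality using (_≡_; _≢_)
open import Relation.Nullary using (¬_; Dec; yes; no; does)
open import Relation.Nullary.Decidable using (_×-dec_; _⊎-dec_; map′; ¬?)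

-- Since the set is finite,
-- closure under binary unions/intersections is closure under arbitrary ones.
record Topology (n : ℕ) : Set where
  field
    isOpen  : Subset n → Bool
    ⊥-open  : isOpen ⊥ ≡ true
    ⊤-open  : isOpen ⊤ ≡ true
    ∪-open  : ∀ U V → isOpen U ≡ true → isOpen V ≡ true → isOpen (U ∪ V) ≡ true
    ∩-open  : ∀ U V → isOpen U ≡ true → isOpen V ≡ true → isOpen (U ∩ V) ≡ true
open Topology public

Open : ∀ {n} → Topology n → Subset n → Set
Open T U = isOpen T U ≡ true

IsT0 : ∀ {n} → Topology n → Set
IsT0 {n} T = ∀ (x y : Fin n) → x ≢ y →
  ∃ λ U → Open T U × ((x ∈ U × y ∉ U) ⊎ (y ∈ U × x ∉ U))

_≤[_]_ : ∀ {n} → Fin n → Topology n → Fin n → Set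
x ≤[ T ] y = ∀ U → Open T U → y ∈ U → x ∈ U

_<[_]_ : ∀ {n} → Fin n → Topology n → Fin n → Set
x <[ T ] y = x ≤[ T ] y × x ≢ y

Covers : ∀ {n} → Topology n → Fin n → Fin n → Set
Covers {n} T x y = x <[ T ] y × (∀ (z : Fin n) → ¬ (x <[ T ] z × z <[ T ] y))

HasseEdge : ∀ {n} → Topology n → Fin n → Fin n → Set
HasseEdge T x y = Covers T x y ⊎ Covers T y x

private
  bool≟ : (b : Bool) → Dec (b ≡ true)
  bool≟ true = yes _≡_.refl
  bool≟ false = no (λ ())

≤? : ∀ {n} (T : Topology n) x y → Dec (x ≤[ T ] y)
≤? T x y with anySubset? (λ U → bool≟ (isOpen T U) ×-dec (y ∈? U) ×-dec ¬? (x ∈? U))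
... | yes (U , o , yU , nx) = no (λ h → nx (h U o yU))
... | no ¬w = yes (λ U o yU → dec-stable U o yU)
  where
  dec-stable : ∀ U → Open T U → y ∈ U → x ∈ U
  dec-stable U o yU with x ∈? U
  ... | yes p = p
  ... | no np = Data.Empty.⊥-elim (¬w (U , o , yU , np))
    where import Data.Empty

<? : ∀ {n} (T : Topology n) x y → Dec (x <[ T ] y)
<? T x y = ≤? T x y ×-dec ¬? (x ≟ y)

Covers? : ∀ {n} (T : Topology n) x y → Dec (Covers T x y)
Covers? T x y = <? T x y ×-dec
  map′ (λ h z p → h (z , p)) (λ h (z , p) → h z p)
       (¬? (any? (λ z → <? T x z ×-dec <? T z y)))

HasseEdge? : ∀ {n} (T : Topology n) x y → Dec (HasseEdge T x y)
HasseEdge? T x y = Covers? T x y ⊎-dec Covers? T y x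

EdgeSet : ∀ {n N} → (Fin N → Topology n) → Fin n → Fin n → Set
EdgeSet T x y = ∃ λ i → HasseEdge (T i) x y

-- p⁻¹ in ℚ (only applied to primes, which are nonzero)
inv : ℕ → ℚ
inv zero = 0ℚ
inv (suc k) = + 1 / suc k

weight : ∀ {n N} → (Fin N → ℕ) → (Fin N → Topology n) → Fin n → Fin n → ℚ
weight {N = N} p T x y =
  foldr _*_ 1ℚ
    (map (λ i → if does (HasseEdge? (T i) x y) then inv (p i) else 1ℚ) (allFinL N))

data Chain {n} (T : Topology n) : ℕ → Fin n → Set where
  start : ∀ v → Chain T 0 v
  step  : ∀ {k u v} → Chain T k u → u <[ T ] v → Chain T (suc k) v

IsDim : ∀ {n} → Topology n → Fin n → ℕ → Set
IsDim T v k = Chain T k v × (∀ m → Chain T m v → m ≤ k)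

module Submission where

-- Since ℚ is kept in lowest terms, the weight ∏_{i ∈ I(e)} p_i⁻¹ of an edge e has
-- denominator ∏_{i ∈ I(e)} p_i, from which unique factorisation recovers I(e); hence
-- every Hasse graph G_i is determined. The dimension d_i strictly increases along each
-- covering x ⋖ y, so it orients the edges of G_i and recovers H_i. In a finite poset ≤
-- is the reflexive-transitive closure of ⋖, and the open sets of a finite space are
-- exactly the down-sets of its specialisation order, so T_i is determined as well.

open import Defs
open import Data.Bool using (true; if_then_else_) renaming (_≟_ to _≟ᵇ_)
open import Data.Bool.Properties using (⇔→≡)
open import Data.Fin using (Fin; _≟_)
open import Data.Fin.Properties using (any?)
open import Data.Fin.Subset using (Subset; _∈_; _⊆_; ⊤; ⋃; ⋂)
open import Data.Fin.Subset.Properties using (_∈?_; anySubset?; ∈⊤; ∉⊥; x∈p∪q⁺; x∈p∪q⁻; x∈p∩q⁺; x∈p∩q⁻; ⊆-antisym)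
open import Data.Integer using (+_)
open import Data.List using (List; []; _∷_; foldr; map; filter; allFin)
open import Data.List.Membership.Propositional using () renaming (_∈_ to _∈ₗ_)
open import Data.List.Membership.Propositional.Properties using (∈-map⁺; ∈-allFin; ∈-filter⁺; ∈-filter⁻)
open import Data.List.Relation.Unary.Any as Any using (Any; here; there; satisfied)
open import Data.List.Relation.Unary.Any.Properties using (map⁻)
open import Data.Nat as ℕ using (ℕ; zero; suc; NonZero; _<_; _≤_; _+_)
open import Data.Nat.Coprimality using (1-coprimeTo)
open import Data.Nat.Divisibility using (_∣_; ∣1⇒≡1)
open import Data.Nat.ListAction using (product)
open import Data.Nat.ListAction.Properties using (∈⇒∣product)
open import Data.Nat.Primality using (Prime; euclidsLemma; prime⇒irreducible; prime⇒nonZero; ¬prime[1])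
open import Data.Nat.Properties using (<⇒≱; <⇒≯; +-suc; m≤m+n; ≤-pred; ≤-trans; +-monoʳ-≤; module ≤-Reasoning)
open import Data.Product using (_×_; _,_; ∃-syntax; proj₁; proj₂)
open import Data.Rational using (ℚ; mkℚ; ↥_; ↧ₙ_; _*_; 1ℚ; normalize)
open import Data.Rational.Properties using (normalize-coprime)
open import Data.Sum using (inj₁; inj₂; [_,_]′)
open import Function using (_∘_)
open import Function.Bundles using (_⇔_; mk⇔; Equivalence)
open import Function.Definitions using (Injective)
open import Relation.Binary.Core using (_Preserves_⟶_)
open import Relation.Binary.Construct.Closure.ReflexiveTransitive as Star using (Star; ε; _◅_; _◅◅_)
open import Relation.Binary.PropositionalEquality
open import Relation.Nullary using (¬_; yes; no; does; contradiction; ¬?)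
open import Relation.Nullary.Decidable using (_×-dec_; dec-true; decidable-stable)
open import Relation.Unary using (Pred; Decidable)

prime⇒≢1 : ∀ {q} → Prime q → q ≢ 1
prime⇒≢1 pq q≡1 = ¬prime[1] (subst Prime q≡1 pq)

prime∤1 : ∀ {q} → Prime q → ¬ q ∣ 1
prime∤1 pq = prime⇒≢1 pq ∘ ∣1⇒≡1

prime∣product⇒∣∈ : ∀ {q ns} → Prime q → q ∣ product ns → Any (q ∣_) ns
prime∣product⇒∣∈ {ns = []}     pq q∣1 = contradiction q∣1 (prime∤1 pq)
prime∣product⇒∣∈ {ns = m ∷ ns} pq q∣mn =
  [ here , there ∘ prime∣product⇒∣∈ pq ]′ (euclidsLemma m (product ns) pq q∣mn)

record Reciprocal (m : ℕ) (q : ℚ) : Set where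
  constructor mkReciprocal
  field
    numerator≡1   : ↥ q ≡ + 1
    denominator≡m : ↧ₙ q ≡ m

reciprocal-normalize : ∀ m .{{_ : NonZero m}} → Reciprocal m (normalize 1 m)
reciprocal-normalize (suc m) rewrite normalize-coprime {1} {m} (1-coprimeTo (suc m)) =
  mkReciprocal refl refl

reciprocal-* : ∀ {m m′ q r} → Reciprocal m q → Reciprocal m′ r → Reciprocal (m ℕ.* m′) (q * r)
reciprocal-* {q = mkℚ _ a _} {r = mkℚ _ b _} (mkReciprocal refl refl) (mkReciprocal refl refl) =
  reciprocal-normalize (suc a ℕ.* suc b)

reciprocal-inv : ∀ m .{{_ : NonZero m}} → Reciprocal m (inv m)
reciprocal-inv (suc m) = reciprocal-normalize (suc m)

module _ {N : ℕ} (p : Fin N → ℕ) where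

  module _ {ℓ} {P : Pred (Fin N) ℓ} (P? : Decidable P) where

    primeFactor : Fin N → ℕ
    primeFactor j = if does (P? j) then p j else 1

    inverseFactor : Fin N → ℚ
    inverseFactor j = if does (P? j) then inv (p j) else 1ℚ

    selectionProduct : List (Fin N) → ℕ
    selectionProduct = product ∘ map primeFactor

    selectionWeight : List (Fin N) → ℚ
    selectionWeight = foldr _*_ 1ℚ ∘ map inverseFactor

    selected⇒∣selectionProduct : ∀ {i L} → i ∈ₗ L → P i → p i ∣ selectionProduct L
    selected⇒∣selectionProduct {i} i∈L Pi =
      subst (_∣ _) (cong (if_then p i else 1) (dec-true (P? i) Pi)) (∈⇒∣product (∈-map⁺ primeFactor i∈L))

    module _ (p≢0 : ∀ j → NonZero (p j)) where

      inverseFactor-reciprocal : ∀ j → Reciprocal (primeFactor j) (inverseFactor j)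
      inverseFactor-reciprocal j with P? j
      ... | yes _ = reciprocal-inv (p j) {{p≢0 j}}
      ... | no  _ = mkReciprocal refl refl

      selectionWeight-reciprocal : ∀ L → Reciprocal (selectionProduct L) (selectionWeight L)
      selectionWeight-reciprocal []      = mkReciprocal refl refl
      selectionWeight-reciprocal (j ∷ L) =
        reciprocal-* (inverseFactor-reciprocal j) (selectionWeight-reciprocal L)

    module _ (prime : ∀ j → Prime (p j)) (p-injective : Injective _≡_ _≡_ p) where

      prime∣primeFactor⇒selected : ∀ {i j} → p i ∣ primeFactor j → P j × i ≡ j
      prime∣primeFactor⇒selected {i} {j} pi∣ with P? j
      ... | no  _  = contradiction pi∣ (prime∤1 (prime i))
      ... | yes Pj with prime⇒irreducible (prime j) pi∣
      ...   | inj₁ pi≡1  = contradiction pi≡1 (prime⇒≢1 (prime i))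
      ...   | inj₂ pi≡pj = Pj , p-injective pi≡pj

      prime∣selectionProduct⇒selected : ∀ {i} L → p i ∣ selectionProduct L → P i
      prime∣selectionProduct⇒selected {i} L pi∣
        with _ , Pj , refl ← satisfied (Any.map (prime∣primeFactor⇒selected {i})
                                       (map⁻ {f = primeFactor} {xs = L} (prime∣product⇒∣∈ (prime i) pi∣)))
        = Pj

  selectionWeight-≡⇒⊆ : (∀ j → Prime (p j)) → Injective _≡_ _≡_ p →
    ∀ {ℓ} {P Q : Pred (Fin N) ℓ} (P? : Decidable P) (Q? : Decidable Q) →
    selectionWeight P? (allFin N) ≡ selectionWeight Q? (allFin N) → ∀ {i} → P i → Q i
  selectionWeight-≡⇒⊆ prime p-injective P? Q? eq {i} Pi =
    prime∣selectionProduct⇒selected Q? prime p-injective (allFin N)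
      (subst (p i ∣_) products-equal (selected⇒∣selectionProduct P? (∈-allFin i) Pi))
    where
    p≢0 : ∀ j → NonZero (p j)
    p≢0 j = prime⇒nonZero (prime j)

    products-equal : selectionProduct P? (allFin N) ≡ selectionProduct Q? (allFin N)
    products-equal = begin
      selectionProduct P? (allFin N)    ≡⟨ denominator≡m (selectionWeight-reciprocal P? p≢0 (allFin N)) ⟨
      ↧ₙ selectionWeight P? (allFin N)  ≡⟨ cong ↧ₙ_ eq ⟩
      ↧ₙ selectionWeight Q? (allFin N)  ≡⟨ denominator≡m (selectionWeight-reciprocal Q? p≢0 (allFin N)) ⟩
      selectionProduct Q? (allFin N)    ∎
      where
      open ≡-Reasoning
      open Reciprocal

weight-≡⇒hasseEdge : ∀ {N} {p : Fin N → ℕ} → (∀ j → Prime (p j)) → Injective _≡_ _≡_ p →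
  ∀ {n} (T T′ : Fin N → Topology n) {x y} → weight p T x y ≡ weight p T′ x y →
  ∀ {i} → HasseEdge (T i) x y → HasseEdge (T′ i) x y
weight-≡⇒hasseEdge {p = p} prime p-injective T T′ {x} {y} =
  selectionWeight-≡⇒⊆ p prime p-injective (λ j → HasseEdge? (T j) x y) (λ j → HasseEdge? (T′ j) x y)

module _ {n : ℕ} {A : Set} (W : A → Subset n) where

  ⋂-open : ∀ (T : Topology n) xs → (∀ {a} → a ∈ₗ xs → Open T (W a)) → Open T (⋂ (map W xs))
  ⋂-open T []       _      = ⊤-open T
  ⋂-open T (a ∷ xs) W-open = ∩-open T _ _ (W-open (here refl)) (⋂-open T xs (W-open ∘ there))

  ⋃-open : ∀ (T : Topology n) xs → (∀ {a} → a ∈ₗ xs → Open T (W a)) → Open T (⋃ (map W xs))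
  ⋃-open T []       _      = ⊥-open T
  ⋃-open T (a ∷ xs) W-open = ∪-open T _ _ (W-open (here refl)) (⋃-open T xs (W-open ∘ there))

  x∈⋂⁺ : ∀ {x} xs → (∀ {a} → a ∈ₗ xs → x ∈ W a) → x ∈ ⋂ (map W xs)
  x∈⋂⁺ []       _   = ∈⊤
  x∈⋂⁺ (a ∷ xs) x∈W = x∈p∩q⁺ (x∈W (here refl) , x∈⋂⁺ xs (x∈W ∘ there))

  x∈⋂⁻ : ∀ {x a} xs → x ∈ ⋂ (map W xs) → a ∈ₗ xs → x ∈ W a
  x∈⋂⁻ (b ∷ xs) x∈⋂ (here refl) = proj₁ (x∈p∩q⁻ (W b) _ x∈⋂)
  x∈⋂⁻ (b ∷ xs) x∈⋂ (there a∈)  = x∈⋂⁻ xs (proj₂ (x∈p∩q⁻ (W b) _ x∈⋂)) a∈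

  x∈⋃⁺ : ∀ {x a} xs → a ∈ₗ xs → x ∈ W a → x ∈ ⋃ (map W xs)
  x∈⋃⁺ (b ∷ xs) (here refl) x∈W = x∈p∪q⁺ (inj₁ x∈W)
  x∈⋃⁺ (b ∷ xs) (there a∈)  x∈W = x∈p∪q⁺ (inj₂ (x∈⋃⁺ xs a∈ x∈W))

  x∈⋃⁻ : ∀ {x} xs → x ∈ ⋃ (map W xs) → ∃[ a ] a ∈ₗ xs × x ∈ W a
  x∈⋃⁻ []       x∈⊥ = contradiction x∈⊥ ∉⊥
  x∈⋃⁻ (b ∷ xs) x∈⋃ with x∈p∪q⁻ (W b) _ x∈⋃
  ... | inj₁ x∈W  = b , here refl , x∈W
  ... | inj₂ x∈⋃′ = let (a , a∈ , x∈W) = x∈⋃⁻ xs x∈⋃′ in a , there a∈ , x∈W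

module _ {n : ℕ} (T : Topology n) where

  IsDownSet : Subset n → Set
  IsDownSet U = ∀ {x y} → x ≤[ T ] y → y ∈ U → x ∈ U

  open⇒downSet : ∀ {U} → Open T U → IsDownSet U
  open⇒downSet o x≤y y∈U = x≤y _ o y∈U

  separatingOpen : ∀ y x → ∃[ W ] Open T W × y ∈ W × (x ∈ W → x ≤[ T ] y)
  separatingOpen y x with anySubset? (λ W → (isOpen T W ≟ᵇ true) ×-dec y ∈? W ×-dec ¬? (x ∈? W))
  ... | yes (W , o , y∈W , x∉W) = W , o , y∈W , λ x∈W → contradiction x∈W x∉W
  ... | no ∄W = ⊤ , ⊤-open T , ∈⊤ , λ _ W o y∈W →
    decidable-stable (x ∈? W) λ x∉W → ∄W (W , o , y∈W , x∉W)

  separator : Fin n → Fin n → Subset n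
  separator y = proj₁ ∘ separatingOpen y

  minimalNbhd : Fin n → Subset n
  minimalNbhd y = ⋂ (map (separator y) (allFin n))

  minimalNbhd-open : ∀ y → Open T (minimalNbhd y)
  minimalNbhd-open y = ⋂-open (separator y) T (allFin n) λ {x} _ → proj₁ (proj₂ (separatingOpen y x))

  y∈minimalNbhd : ∀ y → y ∈ minimalNbhd y
  y∈minimalNbhd y = x∈⋂⁺ (separator y) (allFin n) λ {x} _ → proj₁ (proj₂ (proj₂ (separatingOpen y x)))

  minimalNbhd⊆↓ : ∀ {x y} → x ∈ minimalNbhd y → x ≤[ T ] y
  minimalNbhd⊆↓ {x} {y} x∈ =
    proj₂ (proj₂ (proj₂ (separatingOpen y x))) (x∈⋂⁻ (separator y) (allFin n) x∈ (∈-allFin x))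

  downSet⇒open : ∀ {U} → IsDownSet U → Open T U
  downSet⇒open {U} down =
    subst (Open T) (⊆-antisym ⋃⊆U U⊆⋃) (⋃-open minimalNbhd T points λ {y} _ → minimalNbhd-open y)
    where
    points : List (Fin n)
    points = filter (_∈? U) (allFin n)

    ⋃⊆U : ⋃ (map minimalNbhd points) ⊆ U
    ⋃⊆U x∈⋃ with x∈⋃⁻ minimalNbhd points x∈⋃
    ... | y , y∈points , x∈↓y = down (minimalNbhd⊆↓ x∈↓y) (proj₂ (∈-filter⁻ (_∈? U) {xs = allFin n} y∈points))

    U⊆⋃ : U ⊆ ⋃ (map minimalNbhd points)
    U⊆⋃ {x} x∈U = x∈⋃⁺ minimalNbhd points (∈-filter⁺ (_∈? U) (∈-allFin x) x∈U) (y∈minimalNbhd x)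

module _ {n : ℕ} (T : Topology n) where

  dim-monotone : ∀ {d} → (∀ v → IsDim T v (d v)) → d Preserves _<[ T ]_ ⟶ _<_
  dim-monotone {d} dim {x} {y} x<y = proj₂ (dim y) (suc (d x)) (step (proj₁ (dim x)) x<y)

  covers*⇒≤ : ∀ {x y} → Star (Covers T) x y → x ≤[ T ] y
  covers*⇒≤ ε                          _ _ y∈U = y∈U
  covers*⇒≤ (((x≤z , _) , _) ◅ z→*y) U o y∈U = x≤z U o (covers*⇒≤ z→*y U o y∈U)

  ≤⇒covers* : ∀ {r} → r Preserves _<[ T ]_ ⟶ _<_ → ∀ {x y} → x ≤[ T ] y → Star (Covers T) x y
  ≤⇒covers* {r} rank {x} {y} x≤y = go (r y) x≤y (m≤m+n (r y) (r x))
    where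
    go : ∀ k {x y} → x ≤[ T ] y → r y ≤ k + r x → Star (Covers T) x y
    go k {x} {y} x≤y gap with x ≟ y | any? (λ z → <? T x z ×-dec <? T z y)
    ... | yes refl | _      = ε
    ... | no x≢y   | no ∄z = ((x≤y , x≢y) , λ z x<z<y → ∄z (z , x<z<y)) ◅ ε
    go zero    {x} {y} x≤y gap | no x≢y | yes _ = contradiction gap (<⇒≱ (rank (x≤y , x≢y)))
    go (suc k) {x} {y} x≤y gap | no x≢y | yes (z , x<z , z<y) =
      go k (proj₁ x<z) (≤-pred (≤-trans (rank z<y) gap)) ◅◅ go k (proj₁ z<y) gap′
      where
      open ≤-Reasoning

      gap′ : r y ≤ k + r z
      gap′ = begin
        r y            ≤⟨ gap ⟩
        suc (k + r x)  ≡⟨ +-suc k (r x) ⟨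
        k + suc (r x)  ≤⟨ +-monoʳ-≤ k (rank x<z) ⟩
        k + r z        ∎

module _ {n : ℕ} {T T′ : Topology n} {r : Fin n → ℕ}
         (rank : r Preserves _<[ T ]_ ⟶ _<_) (rank′ : r Preserves _<[ T′ ]_ ⟶ _<_) where

  covers-transfer : ∀ {x y} → (HasseEdge T x y → HasseEdge T′ x y) → Covers T x y → Covers T′ x y
  covers-transfer edge x⋖y with edge (inj₁ x⋖y)
  ... | inj₁ x⋖′y = x⋖′y
  ... | inj₂ y⋖′x = contradiction (rank′ (proj₁ y⋖′x)) (<⇒≯ (rank (proj₁ x⋖y)))

  ≤-transfer : (∀ {x y} → HasseEdge T x y → HasseEdge T′ x y) → ∀ {x y} → x ≤[ T ] y → x ≤[ T′ ] y
  ≤-transfer edge = covers*⇒≤ T′ ∘ Star.map (covers-transfer edge) ∘ ≤⇒covers* T rank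

opens-antitone : ∀ {n} (T T′ : Topology n) → (∀ {x y} → x ≤[ T ] y → x ≤[ T′ ] y) →
  ∀ {U} → Open T′ U → Open T U
opens-antitone T T′ ≤⇒≤′ U′-open = downSet⇒open T λ x≤y → open⇒downSet T′ U′-open (≤⇒≤′ x≤y)

lemma2p1 : ∀ {n N : ℕ} (p : Fin N → ℕ) → (∀ i → Prime (p i)) → Injective _≡_ _≡_ p →
    (T T′ : Fin N → Topology n) → (∀ i → IsT0 (T i)) → (∀ i → IsT0 (T′ i)) →
    (d d′ : Fin N → Fin n → ℕ) →
    (∀ i v → IsDim (T i) v (d i v)) → (∀ i v → IsDim (T′ i) v (d′ i v)) →
    (∀ x y → EdgeSet T x y ⇔ EdgeSet T′ x y) →
    (∀ x y → EdgeSet T x y → weight p T x y ≡ weight p T′ x y) →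
    (∀ i v → d i v ≡ d′ i v) →
    ∀ i (U : Subset n) → isOpen (T i) U ≡ isOpen (T′ i) U
lemma2p1 p prime p-injective T T′ _ _ d d′ dim dim′ E≡E′ w≡w′ d≡d′ i U =
  ⇔→≡ (mk⇔ (opens-antitone (T′ i) (T i) ≤′⇒≤) (opens-antitone (T i) (T′ i) ≤⇒≤′))
  where
  edge⇒edge′ : ∀ {x y} → HasseEdge (T i) x y → HasseEdge (T′ i) x y
  edge⇒edge′ {x} {y} e = weight-≡⇒hasseEdge prime p-injective T T′ (w≡w′ x y (i , e)) e

  edge′⇒edge : ∀ {x y} → HasseEdge (T′ i) x y → HasseEdge (T i) x y
  edge′⇒edge {x} {y} e′ =
    weight-≡⇒hasseEdge prime p-injective T′ T (sym (w≡w′ x y (Equivalence.from (E≡E′ x y) (i , e′)))) e′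

  rank : d i Preserves _<[ T i ]_ ⟶ _<_
  rank = dim-monotone (T i) (dim i)

  rank′ : d i Preserves _<[ T′ i ]_ ⟶ _<_
  rank′ = dim-monotone (T′ i) λ v → subst (IsDim (T′ i) v) (sym (d≡d′ i v)) (dim′ i v)

  ≤⇒≤′ : ∀ {x y} → x ≤[ T i ] y → x ≤[ T′ i ] y
  ≤⇒≤′ = ≤-transfer {T = T i} {T′ i} rank rank′ edge⇒edge′

  ≤′⇒≤ : ∀ {x y} → x ≤[ T′ i ] y → x ≤[ T i ] y
  ≤′⇒≤ = ≤-transfer {T = T′ i} {T i} rank′ rank edge′⇒edge
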